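{- Let $G$ be a (bull, diamond)-free graph and let $a_0-a_1-\dots-a_k-a_0$ be an induced cycle of length at least $5$ in $G$. Then for every $i$, the vertices $a_i$ and $a_{i+1}$ (indices taken modulo $k+1$) have no common neighbour in $G$.
   Context: Graphs are finite, simple, undirected. A bull is a triangle with two pendant edges attached at two different vertices of the triangle; a diamond is $K_4$ minus one edge. (bull, diamond)-free means no induced bull and no induced diamond. -}

module Defs where

open import Data.Nat using (ℕ; suc; _≤_; _+_)
open import Data.Nat.DivMod using (_mod_)
open import Data.Fin using (Fin; toℕ; zero; suc)
open import Data.Product using (Σ; _×_; _,_)
open import Relation.Binary.PropositionalEquality using (_≡_)
open import Relation.Nullary using (¬_)
open import Function.Definitions using (Injective)
open import Data.Empty using (⊥)
open import Data.Unit using (⊤)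
open import Data.Sum using (_⊎_)

record Graph (n : ℕ) : Set₁ where
  field
    Adj     : Fin n → Fin n → Set
    sym     : ∀ {x y} → Adj x y → Adj y x
    irrefl  : ∀ {x} → ¬ Adj x x

open Graph public

InducedEmbedding : ∀ {m n} → Graph m → Graph n → (Fin m → Fin n) → Set
InducedEmbedding H G f =
  Injective _≡_ _≡_ f × (∀ x y → (Adj H x y → Adj G (f x) (f y)) × (Adj G (f x) (f y) → Adj H x y))

ContainsInduced : ∀ {m n} → Graph n → Graph m → Set
ContainsInduced G H = Σ _ (λ f → InducedEmbedding H G f)

-- Diamond: vertices 0,1,2,3; all edges except 0–3.
-- (edges 01,02,12,13,23)
diamondE : Fin 4 → Fin 4 → Set
diamondE zero (suc zero) = ⊤
diamondE zero (suc (suc zero)) = ⊤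
diamondE (suc zero) (suc (suc zero)) = ⊤
diamondE (suc zero) (suc (suc (suc zero))) = ⊤
diamondE (suc (suc zero)) (suc (suc (suc zero))) = ⊤
diamondE _ _ = ⊥

diamondAdj : Fin 4 → Fin 4 → Set
diamondAdj x y = diamondE x y ⊎ diamondE y x

-- Bull: triangle 0,1,2 with pendant 3 attached to 0 and pendant 4 attached to 1.
bullE : Fin 5 → Fin 5 → Set
bullE zero (suc zero) = ⊤
bullE zero (suc (suc zero)) = ⊤
bullE (suc zero) (suc (suc zero)) = ⊤
bullE zero (suc (suc (suc zero))) = ⊤
bullE (suc zero) (suc (suc (suc (suc zero)))) = ⊤
bullE _ _ = ⊥

bullAdj : Fin 5 → Fin 5 → Set
bullAdj x y = bullE x y ⊎ bullE y x

private
  symOr : ∀ {k} {E : Fin k → Fin k → Set} {x y : Fin k} → E x y ⊎ E y x → E y x ⊎ E x y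
  symOr (Data.Sum.inj₁ p) = Data.Sum.inj₂ p
  symOr (Data.Sum.inj₂ p) = Data.Sum.inj₁ p

diamondIrr : ∀ {x} → ¬ diamondAdj x x
diamondIrr {zero} (Data.Sum.inj₁ ())
diamondIrr {zero} (Data.Sum.inj₂ ())
diamondIrr {suc zero} (Data.Sum.inj₁ ())
diamondIrr {suc zero} (Data.Sum.inj₂ ())
diamondIrr {suc (suc zero)} (Data.Sum.inj₁ ())
diamondIrr {suc (suc zero)} (Data.Sum.inj₂ ())
diamondIrr {suc (suc (suc zero))} (Data.Sum.inj₁ ())
diamondIrr {suc (suc (suc zero))} (Data.Sum.inj₂ ())

bullIrr : ∀ {x} → ¬ bullAdj x x
bullIrr {zero} (Data.Sum.inj₁ ())
bullIrr {zero} (Data.Sum.inj₂ ())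
bullIrr {suc zero} (Data.Sum.inj₁ ())
bullIrr {suc zero} (Data.Sum.inj₂ ())
bullIrr {suc (suc zero)} (Data.Sum.inj₁ ())
bullIrr {suc (suc zero)} (Data.Sum.inj₂ ())
bullIrr {suc (suc (suc zero))} (Data.Sum.inj₁ ())
bullIrr {suc (suc (suc zero))} (Data.Sum.inj₂ ())
bullIrr {suc (suc (suc (suc zero)))} (Data.Sum.inj₁ ())
bullIrr {suc (suc (suc (suc zero)))} (Data.Sum.inj₂ ())

diamond : Graph 4
diamond = record { Adj = diamondAdj ; sym = symOr {E = diamondE} ; irrefl = diamondIrr }

bull : Graph 5
bull = record { Adj = bullAdj ; sym = symOr {E = bullE} ; irrefl = bullIrr }

BullDiamondFree : ∀ {n} → Graph n → Set
BullDiamondFree G = ¬ ContainsInduced G bull × ¬ ContainsInduced G diamond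

nextIdx : ∀ {k} → Fin (suc k) → Fin (suc k)
nextIdx {k} i = (suc (toℕ i)) mod (suc k)

InducedCycle : ∀ {n k} → Graph n → (Fin (suc k) → Fin n) → Set
InducedCycle {k = k} G a =
  Injective _≡_ _≡_ a ×
  (∀ i j → Adj G (a i) (a j) → (j ≡ nextIdx i ⊎ i ≡ nextIdx j)) ×
  (∀ i → Adj G (a i) (a (nextIdx i)))

-- Let v be adjacent to a_i and a_{i+1}. Since the cycle has length at least 5, a_{i-1} a_i a_{i+1} a_{i+2}
-- is an induced path. If v were adjacent to a_{i-1}, then a_{i-1}, a_i, v, a_{i+1} would span a diamond
-- (a_{i-1} and a_{i+1} being the non-adjacent pair), and symmetrically for a_{i+2}. So v sees neither end
-- of the path, and the triangle v a_i a_{i+1} with pendants a_{i-1} and a_{i+2} is an induced bull.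

module Submission where

open import Defs hiding (sym)
open import Data.Nat using (ℕ; suc; zero; _≤_; _<_; _+_; _∸_; _%_; s≤s; z<s; s<s; NonZero)
open import Data.Nat.Properties
  using ( _<?_; ≤-refl; ≤-trans; <-trans; n<1+n; n≤1+n; m<n⇒m<1+n; ≮⇒≥; <⇒≢; m<m+n
        ; +-identityʳ; +-suc; +-cancelˡ-≡; +-cancelʳ-<; +-mono-<; m∸n+n≡m)
open import Data.Nat.DivMod using (%-distribˡ-+; m%n%n≡m%n; m<n⇒m%n≡m; [m+n]%n≡m%n)
open import Data.Fin as Fin using (Fin; toℕ)
open import Data.Fin.Patterns using (0F; 1F; 2F; 3F; 4F)
open import Data.Fin.Properties using (toℕ-injective; toℕ-fromℕ<; toℕ<n; <-cmp)
import Data.List as List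
open import Data.List.Relation.Unary.AllPairs using (AllPairs; []; _∷_)
import Data.List.Relation.Unary.All.Properties as All
open import Data.List.Relation.Unary.All using ([]; _∷_)
open import Relation.Binary.Core using (Rel)
open import Data.Product using (_×_; _,_; proj₁; proj₂)
open import Data.Sum using (inj₁; inj₂; reduce)
open import Data.Unit using (tt)
open import Data.Empty using (⊥-elim)
open import Relation.Binary.Definitions using (tri<; tri≈; tri>)
open import Relation.Binary.PropositionalEquality
open import Relation.Nullary using (¬_; yes; no)

allPairs-tabulate⁻-< : ∀ {a ℓ} {A : Set a} {R : Rel A ℓ} {m} {f : Fin m → A} →
                       AllPairs R (List.tabulate f) → ∀ {i j} → i Fin.< j → R (f i) (f j)
allPairs-tabulate⁻-< (Rf0 ∷ _) {Fin.zero} {Fin.suc j} _ = All.tabulate⁻ Rf0 j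
allPairs-tabulate⁻-< (_ ∷ Rfs) {Fin.suc i} {Fin.suc j} (s≤s i<j) = allPairs-tabulate⁻-< Rfs i<j

module Faithful {m n} (H : Graph m) (G : Graph n) (f : Fin m → Fin n) where

  FaithfulOn : Fin m → Fin m → Set
  FaithfulOn x y = (Adj H x y → Adj G (f x) (f y)) × (Adj G (f x) (f y) → Adj H x y) × f x ≢ f y

  faithfulOn-sym : ∀ {x y} → FaithfulOn x y → FaithfulOn y x
  faithfulOn-sym (preserve , reflect , dist) =
    (λ h → Graph.sym G (preserve (Graph.sym H h))) , (λ g → Graph.sym H (reflect (Graph.sym G g))) , (λ eq → dist (sym eq))

  faithfulOn-edge : ∀ {x y} → Adj H x y → Adj G (f x) (f y) → FaithfulOn x y
  faithfulOn-edge {x} h g = (λ _ → g) , (λ _ → h) , λ eq → irrefl G (subst (Adj G (f x)) (sym eq) g)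

  faithfulOn-nonEdge : ∀ {x y} → ¬ Adj H x y → ¬ Adj G (f x) (f y) → f x ≢ f y → FaithfulOn x y
  faithfulOn-nonEdge ¬h ¬g dist = (λ h → ⊥-elim (¬h h)) , (λ g → ⊥-elim (¬g g)) , dist

  faithful-pairs⇒inducedEmbedding : AllPairs FaithfulOn (List.allFin m) → InducedEmbedding H G f
  faithful-pairs⇒inducedEmbedding faithful = injective , adjacency
    where
    faithfulOn-≢ : ∀ {x y} → x ≢ y → FaithfulOn x y
    faithfulOn-≢ {x} {y} x≢y with <-cmp x y
    ... | tri< x<y _ _ = allPairs-tabulate⁻-< faithful x<y
    ... | tri≈ _ x≡y _ = ⊥-elim (x≢y x≡y)
    ... | tri> _ _ y<x = faithfulOn-sym (allPairs-tabulate⁻-< faithful y<x)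

    injective : ∀ {x y} → f x ≡ f y → x ≡ y
    injective {x} {y} eq with x Fin.≟ y
    ... | yes x≡y = x≡y
    ... | no x≢y = ⊥-elim (proj₂ (proj₂ (faithfulOn-≢ x≢y)) eq)

    adjacency : ∀ x y → (Adj H x y → Adj G (f x) (f y)) × (Adj G (f x) (f y) → Adj H x y)
    adjacency x y with x Fin.≟ y
    ... | yes refl = (λ h → ⊥-elim (irrefl H h)) , (λ g → ⊥-elim (irrefl G g))
    ... | no x≢y = proj₁ (faithfulOn-≢ x≢y) , proj₁ (proj₂ (faithfulOn-≢ x≢y))

-- For a simple graph these (non-)adjacencies already force the four vertices to be distinct.
record InducedP₄ {n} (G : Graph n) (a₀ a₁ a₂ a₃ : Fin n) : Set where
  field
    a₀~a₁ : Adj G a₀ a₁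
    a₁~a₂ : Adj G a₁ a₂
    a₂~a₃ : Adj G a₂ a₃
    a₀≁a₂ : ¬ Adj G a₀ a₂
    a₁≁a₃ : ¬ Adj G a₁ a₃
    a₀≁a₃ : ¬ Adj G a₀ a₃

module _ {n} (G : Graph n) where

  ~-sym : ∀ {x y} → Adj G x y → Adj G y x
  ~-sym = Graph.sym G

  ≁-sym : ∀ {x y} → ¬ Adj G x y → ¬ Adj G y x
  ≁-sym x≁y y~x = x≁y (~-sym y~x)

  adj-nonAdj⇒≢ : ∀ {z x y} → Adj G z x → ¬ Adj G z y → x ≢ y
  adj-nonAdj⇒≢ z~x z≁y refl = z≁y z~x

  -- A non-edge of diamond or bull has adjacency ⊥ ⊎ ⊥, which reduce refutes.
  diamond-at : ∀ {p q r s} → Adj G p q → Adj G p r → Adj G q r → Adj G q s → Adj G r s →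
               ¬ Adj G p s → p ≢ s → ContainsInduced G diamond
  diamond-at {p} {q} {r} {s} pq pr qr qs rs ¬ps p≢s = f , faithful-pairs⇒inducedEmbedding faithful
    where
    f : Fin 4 → Fin n
    f 0F = p
    f 1F = q
    f 2F = r
    f 3F = s

    open Faithful diamond G f

    faithful : AllPairs FaithfulOn (List.allFin 4)
    faithful = (faithfulOn-edge (inj₁ tt) pq ∷ faithfulOn-edge (inj₁ tt) pr ∷ faithfulOn-nonEdge reduce ¬ps p≢s ∷ [])
             ∷ (faithfulOn-edge (inj₁ tt) qr ∷ faithfulOn-edge (inj₁ tt) qs ∷ [])
             ∷ (faithfulOn-edge (inj₁ tt) rs ∷ [])
             ∷ []
             ∷ []

  bull-at : ∀ {p q r s t} → Adj G p q → Adj G p r → Adj G q r → Adj G p s → Adj G q t →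
            ¬ Adj G p t → ¬ Adj G q s → ¬ Adj G r s → ¬ Adj G r t → ¬ Adj G s t →
            ContainsInduced G bull
  bull-at {p} {q} {r} {s} {t} pq pr qr ps qt ¬pt ¬qs ¬rs ¬rt ¬st = f , faithful-pairs⇒inducedEmbedding faithful
    where
    f : Fin 5 → Fin n
    f 0F = p
    f 1F = q
    f 2F = r
    f 3F = s
    f 4F = t

    open Faithful bull G f

    faithful : AllPairs FaithfulOn (List.allFin 5)
    faithful = (faithfulOn-edge (inj₁ tt) pq ∷ faithfulOn-edge (inj₁ tt) pr ∷ faithfulOn-edge (inj₁ tt) ps
                 ∷ faithfulOn-nonEdge reduce ¬pt (adj-nonAdj⇒≢ (~-sym ps) ¬st) ∷ [])
             ∷ (faithfulOn-edge (inj₁ tt) qr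
                 ∷ faithfulOn-nonEdge reduce ¬qs (adj-nonAdj⇒≢ (~-sym qt) (≁-sym ¬st))
                 ∷ faithfulOn-edge (inj₁ tt) qt ∷ [])
             ∷ (faithfulOn-nonEdge reduce ¬rs (adj-nonAdj⇒≢ qr ¬qs)
                 ∷ faithfulOn-nonEdge reduce ¬rt (adj-nonAdj⇒≢ pr ¬pt) ∷ [])
             ∷ (faithfulOn-nonEdge reduce ¬st (adj-nonAdj⇒≢ ps ¬pt) ∷ [])
             ∷ []
             ∷ []

  inducedP₄-middleEdge-noCommonNeighbour : BullDiamondFree G → ∀ {a₀ a₁ a₂ a₃} → InducedP₄ G a₀ a₁ a₂ a₃ →
                                           ∀ v → ¬ (Adj G v a₁ × Adj G v a₂)
  inducedP₄-middleEdge-noCommonNeighbour (noBull , noDiamond) {a₀} {a₁} {a₂} {a₃} P v (v~a₁ , v~a₂) =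
    noBull (bull-at a₁~a₂ (~-sym v~a₁) (~-sym v~a₂) (~-sym a₀~a₁) a₂~a₃ a₁≁a₃ (≁-sym a₀≁a₂) v≁a₀ v≁a₃ a₀≁a₃)
    where
    open InducedP₄ P

    v≁a₀ : ¬ Adj G v a₀
    v≁a₀ v~a₀ = noDiamond (diamond-at a₀~a₁ (~-sym v~a₀) (~-sym v~a₁) a₁~a₂ v~a₂ a₀≁a₂
                                      (≢-sym (adj-nonAdj⇒≢ (~-sym a₂~a₃) (≁-sym a₀≁a₃))))

    v≁a₃ : ¬ Adj G v a₃
    v≁a₃ v~a₃ = noDiamond (diamond-at a₁~a₂ (~-sym v~a₁) (~-sym v~a₂) a₂~a₃ v~a₃ a₁≁a₃
                                      (adj-nonAdj⇒≢ a₀~a₁ a₀≁a₃))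

[1+m%n]%n≡[1+m]%n : ∀ m n .{{_ : NonZero n}} → suc (m % n) % n ≡ suc m % n
[1+m%n]%n≡[1+m]%n m n = begin
  (1 + m % n) % n           ≡⟨ %-distribˡ-+ 1 (m % n) n ⟩
  (1 % n + m % n % n) % n   ≡⟨ cong (λ x → (1 % n + x) % n) (m%n%n≡m%n m n) ⟩
  (1 % n + m % n) % n       ≡⟨ sym (%-distribˡ-+ 1 m n) ⟩
  (1 + m) % n               ∎
  where open ≡-Reasoning

[m+n]%o≢m : ∀ {m n o} .{{_ : NonZero o}} → m < o → 0 < n → n < o → (m + n) % o ≢ m
[m+n]%o≢m {m} {n} {o} m<o 0<n n<o eq with m + n <? o
... | yes m+n<o = <⇒≢ (m<m+n m 0<n) (trans (sym eq) (m<n⇒m%n≡m m+n<o))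
... | no m+n≮o = <⇒≢ n<o (sym (+-cancelˡ-≡ m o n m+o≡m+n))
  where
  d : ℕ
  d = m + n ∸ o
  d+o≡m+n : d + o ≡ m + n
  d+o≡m+n = m∸n+n≡m (≮⇒≥ m+n≮o)
  d<o : d < o
  d<o = +-cancelʳ-< o d o (subst (_< o + o) (sym d+o≡m+n) (+-mono-< m<o n<o))
  d≡m : d ≡ m
  d≡m = begin
    d             ≡⟨ sym (m<n⇒m%n≡m d<o) ⟩
    d % o         ≡⟨ sym ([m+n]%n≡m%n d o) ⟩
    (d + o) % o   ≡⟨ cong (_% o) d+o≡m+n ⟩
    (m + n) % o   ≡⟨ eq ⟩
    m             ∎
    where open ≡-Reasoning
  m+o≡m+n : m + o ≡ m + n
  m+o≡m+n = trans (cong (_+ o) (sym d≡m)) d+o≡m+n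

module Cyclic {k : ℕ} where

  open import Function.Endo.Propositional (Fin (suc k)) using (_^_)

  ^-suc : ∀ f c i → (f ^ suc c) i ≡ (f ^ c) (f i)
  ^-suc f zero i = refl
  ^-suc f (suc c) i = cong f (^-suc f c i)

  toℕ-nextIdx^ : ∀ c i → toℕ ((nextIdx ^ c) i) ≡ (toℕ i + c) % suc k
  toℕ-nextIdx^ zero i = sym (trans (cong (_% suc k) (+-identityʳ (toℕ i))) (m<n⇒m%n≡m (toℕ<n i)))
  toℕ-nextIdx^ (suc c) i = begin
    toℕ ((nextIdx ^ suc c) i)             ≡⟨ toℕ-fromℕ< _ ⟩
    suc (toℕ ((nextIdx ^ c) i)) % suc k   ≡⟨ cong (λ x → suc x % suc k) (toℕ-nextIdx^ c i) ⟩
    suc ((toℕ i + c) % suc k) % suc k     ≡⟨ [1+m%n]%n≡[1+m]%n (toℕ i + c) (suc k) ⟩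
    suc (toℕ i + c) % suc k               ≡⟨ cong (_% suc k) (sym (+-suc (toℕ i) c)) ⟩
    (toℕ i + suc c) % suc k               ∎
    where open ≡-Reasoning

  nextIdx^-≢ : ∀ {c} → 0 < c → c < suc k → ∀ i → (nextIdx ^ c) i ≢ i
  nextIdx^-≢ {c} 0<c c<1+k i eq = [m+n]%o≢m (toℕ<n i) 0<c c<1+k (trans (sym (toℕ-nextIdx^ c i)) (cong toℕ eq))

  predIdx : Fin (suc k) → Fin (suc k)
  predIdx = nextIdx ^ k

  nextIdx-predIdx : ∀ i → nextIdx (predIdx i) ≡ i
  nextIdx-predIdx i = toℕ-injective (begin
    toℕ ((nextIdx ^ suc k) i)   ≡⟨ toℕ-nextIdx^ (suc k) i ⟩
    (toℕ i + suc k) % suc k     ≡⟨ [m+n]%n≡m%n (toℕ i) (suc k) ⟩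
    toℕ i % suc k               ≡⟨ m<n⇒m%n≡m (toℕ<n i) ⟩
    toℕ i                       ∎)
    where open ≡-Reasoning

  module _ {n} {G : Graph n} {a : Fin (suc k) → Fin n} (cycle : InducedCycle G a) where

    inducedCycle-nonAdj : ∀ {c} → 2 ≤ c → c < k → ∀ i → ¬ Adj G (a i) (a ((nextIdx ^ c) i))
    inducedCycle-nonAdj {suc c} (s≤s 1≤c) 1+c<k i ai~aj with proj₁ (proj₂ cycle) i _ ai~aj
    ... | inj₁ aj≡ai+1 = nextIdx^-≢ 1≤c (m<n⇒m<1+n (<-trans (n<1+n c) 1+c<k)) (nextIdx i)
                                    (trans (sym (^-suc nextIdx c i)) aj≡ai+1)
    ... | inj₂ ai≡aj+1 = nextIdx^-≢ z<s (s<s 1+c<k) i (sym ai≡aj+1)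

    inducedCycle⇒inducedP₄ : 5 ≤ suc k → ∀ i →
      InducedP₄ G (a i) (a (nextIdx i)) (a ((nextIdx ^ 2) i)) (a ((nextIdx ^ 3) i))
    inducedCycle⇒inducedP₄ (s≤s 4≤k) i = record
      { a₀~a₁ = edge i
      ; a₁~a₂ = edge (nextIdx i)
      ; a₂~a₃ = edge ((nextIdx ^ 2) i)
      ; a₀≁a₂ = inducedCycle-nonAdj ≤-refl (≤-trans (n≤1+n 3) 4≤k) i
      ; a₁≁a₃ = inducedCycle-nonAdj ≤-refl (≤-trans (n≤1+n 3) 4≤k) (nextIdx i)
      ; a₀≁a₃ = inducedCycle-nonAdj (n≤1+n 2) 4≤k i
      }
      where
      edge : ∀ j → Adj G (a j) (a (nextIdx j))
      edge = proj₂ (proj₂ cycle)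

lemma3p9 : ∀ {n} (G : Graph n) → BullDiamondFree G →
           ∀ k (a : Fin (suc k) → Fin n) → 5 ≤ suc k → InducedCycle G a →
           ∀ i (v : Fin n) → ¬ (Adj G v (a i) × Adj G v (a (nextIdx i)))
lemma3p9 G bullDiamondFree k a 5≤1+k cycle i v (v~aᵢ , v~aᵢ₊₁) =
  inducedP₄-middleEdge-noCommonNeighbour G bullDiamondFree (inducedCycle⇒inducedP₄ cycle 5≤1+k (predIdx i)) v
    ( subst (λ j → Adj G v (a j)) (sym (nextIdx-predIdx i)) v~aᵢ
    , subst (λ j → Adj G v (a (nextIdx j))) (sym (nextIdx-predIdx i)) v~aᵢ₊₁ )
  where open Cyclic
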